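{- Let $A,B\subseteq\mathbb{Z}$ be finite sets with $|A|=3$ and $|B|\ge 2$. Then $|A\widehat{+}B|=|A|+|B|-3$ if and only if $A=B$.
   Context: For finite sets $A,B\subseteq\mathbb{Z}$, the restricted sumset is $A\widehat{+}B=\{a+b: a\in A,\ b\in B,\ a\neq b\}$. A pair $(A,B)$ with $|A|,|B|\ge 2$ satisfying $|A\widehat{+}B|=|A|+|B|-3$ is called a critical pair; throughout the paper all sets considered have at least two elements. -}

module Defs where

open import Data.Integer using (ℤ; _+_)
open import Data.List using (List)
open import Data.List.Membership.Propositional using (_∈_)
open import Data.Product using (∃-syntax; _×_)
open import Relation.Binary.PropositionalEquality using (_≡_; _≢_)

-- Finite subsets of ℤ are represented by duplicate-free lists
-- (Data.List.Relation.Unary.Unique); |A| is the length of the list.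

_∈RestrictedSum[_,_] : ℤ → List ℤ → List ℤ → Set
x ∈RestrictedSum[ A , B ] = ∃[ a ] ∃[ b ] (a ∈ A × b ∈ B × a ≢ b × x ≡ a + b)

-- C is a duplicate-free listing of exactly the elements of A +̂ B
-- (uniqueness is required separately).
Lists-RestrictedSum : List ℤ → List ℤ → List ℤ → Set
Lists-RestrictedSum C A B = ∀ x → (x ∈ C → x ∈RestrictedSum[ A , B ]) × (x ∈RestrictedSum[ A , B ] → x ∈ C)

SameSet : List ℤ → List ℤ → Set
SameSet A B = ∀ x → (x ∈ A → x ∈ B) × (x ∈ B → x ∈ A)

{-# OPTIONS --safe #-}
-- Write A = {x < y < z} and let m, M be the least and largest elements of B.  For
-- a ∈ A the translate a + B has |B| elements, all in A +̂ B except possibly a + a.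
-- Hence |A +̂ B| > |B| as soon as, for some pivot a, A +̂ B contains one element
-- outside a + B (if a ∉ B) or two (if a ∈ B); sums below a + m or above a + M
-- will do.  Comparing x with m and z with M, such sums exist unless m = x, M = z
-- and B ⊆ {x, y, z}, which leaves B = A or B = {x, z}; in the latter case x + z
-- lies outside y + B.  Conversely A +̂ A = {x+y, x+z, y+z}.
module Submission where

open import Defs
open import Data.Integer using (ℤ; _+_; _<_; _≤_; _≟_)
open import Data.Integer.Properties
  using (+-comm; +-monoʳ-<; +-monoˡ-<; +-monoʳ-≤; <⇒≢; <⇒≱; <-trans; <-≤-trans; ≤-<-trans;
         ≤-reflexive; <-cmp; ≤-totalOrder; +-0-abelianGroup)
open import Algebra.Properties.AbelianGroup +-0-abelianGroup
  using () renaming (∙-cancelˡ to +-cancelˡ-≡; ∙-cancelʳ to +-cancelʳ-≡)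
open import Data.Nat as ℕ using (suc; z≤n; s≤s; s≤s⁻¹)
import Data.Nat.Properties as ℕ
open import Data.List using (List; []; _∷_; length; map; _++_)
open import Data.List.Properties using (length-map; length-++-sucʳ)
open import Data.List.Extrema ≤-totalOrder
  using (min; max; argmin-sel; argmax-sel; min≤⊤; min≤xs; ⊥≤max; xs≤max)
open import Data.List.Membership.Propositional using (_∈_; _∉_; find)
open import Data.List.Membership.Propositional.Properties using (∈-∃++; ∈-map⁻)
open import Data.List.Membership.DecPropositional _≟_ using (_∈?_)
open import Data.List.Relation.Unary.Any using (here; there)
open import Data.List.Relation.Unary.All as All using (All; []; _∷_; all?)
open import Data.List.Relation.Unary.All.Properties using (¬Any⇒All¬; All¬⇒¬Any; ¬All⇒Any¬)
open import Data.List.Relation.Unary.Unique.Propositional using (Unique; []; _∷_)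
open import Data.List.Relation.Unary.Unique.Propositional.Properties using (map⁺)
open import Data.List.Relation.Binary.Subset.Propositional using (_⊆_)
open import Data.List.Relation.Binary.Subset.Propositional.Properties
  using (⊆-respʳ-↭; ⊆∷∧∉⇒⊆; ∈-∷⁺ʳ)
open import Data.List.Relation.Binary.Permutation.Propositional
  using (_↭_; refl; prep; swap; ↭-trans; ↭-sym)
open import Data.List.Relation.Binary.Permutation.Propositional.Properties
  using (∈-resp-↭; All-resp-↭; shift)
open import Data.Product using (∃-syntax; _×_; _,_; proj₁; proj₂)
open import Data.Sum using (_⊎_; inj₁; inj₂; [_,_]′; map₁)
open import Function using (id; _∘_)
open import Function.Bundles using (_⇔_; mk⇔)
open import Relation.Nullary using (yes; no; contradiction)
open import Relation.Binary.Definitions using (tri<; tri≈; tri>)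
open import Relation.Binary.PropositionalEquality
  using (_≡_; _≢_; refl; sym; trans; cong; cong₂; ≢-sym)

Unique-⊆⇒length≤ : ∀ {a} {X : Set a} {xs ys : List X} →
                    Unique xs → xs ⊆ ys → length xs ℕ.≤ length ys
Unique-⊆⇒length≤ {xs = []} _ _ = z≤n
Unique-⊆⇒length≤ {xs = x ∷ xs} (x∉xs ∷ xs-unique) x∷xs⊆ys
  with us , vs , refl ← ∈-∃++ (x∷xs⊆ys (here refl)) = begin
    suc (length xs)         ≤⟨ s≤s (Unique-⊆⇒length≤ xs-unique xs⊆us++vs) ⟩
    suc (length (us ++ vs)) ≡⟨ sym (length-++-sucʳ us x vs) ⟩
    length (us ++ x ∷ vs)   ∎
  where
    open ℕ.≤-Reasoning
    xs⊆us++vs : xs ⊆ us ++ vs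
    xs⊆us++vs = ⊆∷∧∉⇒⊆ (⊆-respʳ-↭ (shift x us vs) (λ v∈xs → x∷xs⊆ys (there v∈xs)))
                       (All¬⇒¬Any x∉xs)

SameSet⇒length≡ : ∀ {xs ys} → Unique xs → Unique ys → SameSet xs ys → length xs ≡ length ys
SameSet⇒length≡ xs-unique ys-unique xs≈ys =
  ℕ.≤-antisym (Unique-⊆⇒length≤ xs-unique (proj₁ (xs≈ys _)))
              (Unique-⊆⇒length≤ ys-unique (proj₂ (xs≈ys _)))

SameSet-trans : ∀ {xs ys zs} → SameSet xs ys → SameSet ys zs → SameSet xs zs
SameSet-trans xs≈ys ys≈zs v =
  (λ v∈xs → proj₁ (ys≈zs v) (proj₁ (xs≈ys v) v∈xs)) , (λ v∈zs → proj₂ (xs≈ys v) (proj₂ (ys≈zs v) v∈zs))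

↭⇒SameSet : ∀ {xs ys} → xs ↭ ys → SameSet xs ys
↭⇒SameSet xs↭ys v = ∈-resp-↭ xs↭ys , ∈-resp-↭ (↭-sym xs↭ys)

⊆-or-∉ : (xs ys : List ℤ) → xs ⊆ ys ⊎ ∃[ v ] v ∈ xs × v ∉ ys
⊆-or-∉ xs ys with all? (_∈? ys) xs
... | yes xs⊆ys = inj₁ (All.lookup xs⊆ys)
... | no xs⊈ys  = inj₂ (find (¬All⇒Any¬ (_∈? ys) xs xs⊈ys))

min∈ : ∀ b bs → min b bs ∈ b ∷ bs
min∈ b bs = [ here , there ]′ (argmin-sel id b bs)

min≤ : ∀ b bs → All (min b bs ≤_) (b ∷ bs)
min≤ b bs = min≤⊤ b bs ∷ min≤xs b bs

max∈ : ∀ b bs → max b bs ∈ b ∷ bs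
max∈ b bs = [ here , there ]′ (argmax-sel id b bs)

≤max : ∀ b bs → All (_≤ max b bs) (b ∷ bs)
≤max b bs = ⊥≤max b bs ∷ xs≤max b bs

Sorting₃ : List ℤ → Set
Sorting₃ xs = ∃[ x ] ∃[ y ] ∃[ z ] x < y × y < z × xs ↭ x ∷ y ∷ z ∷ []

sort₂ : ∀ {a b} → a ≢ b → ∃[ p ] ∃[ q ] p < q × a ∷ b ∷ [] ↭ p ∷ q ∷ []
sort₂ {a} {b} a≢b with <-cmp a b
... | tri< a<b _ _ = a , b , a<b , refl
... | tri≈ _ a≡b _ = contradiction a≡b a≢b
... | tri> _ _ b<a = b , a , b<a , swap a b refl

insert₃ : ∀ {a p q} → All (a ≢_) (p ∷ q ∷ []) → p < q → Sorting₃ (a ∷ p ∷ q ∷ [])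
insert₃ {a} {p} {q} (a≢p ∷ a≢q ∷ []) p<q with <-cmp a p | <-cmp a q
... | tri< a<p _ _ | _            = a , p , q , a<p , p<q , refl
... | tri≈ _ a≡p _ | _            = contradiction a≡p a≢p
... | tri> _ _ p<a | tri< a<q _ _ = p , a , q , p<a , a<q , swap a p refl
... | tri> _ _ _   | tri≈ _ a≡q _ = contradiction a≡q a≢q
... | tri> _ _ _   | tri> _ _ q<a =
  p , q , a , p<q , q<a , ↭-trans (swap a p refl) (prep p (swap a q refl))

sort₃ : ∀ {a b c} → Unique (a ∷ b ∷ c ∷ []) → Sorting₃ (a ∷ b ∷ c ∷ [])
sort₃ {a} (a≢bc ∷ (b≢c ∷ []) ∷ [] ∷ [])
  with p , q , p<q , bc↭pq ← sort₂ b≢c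
  with x , y , z , x<y , y<z , apq↭xyz ← insert₃ (All-resp-↭ bc↭pq a≢bc) p<q
  = x , y , z , x<y , y<z , ↭-trans (prep a bc↭pq) apq↭xyz

_+̂_⊆_ : List ℤ → List ℤ → List ℤ → Set
A +̂ B ⊆ C = ∀ {a b} → a ∈ A → b ∈ B → a ≢ b → a + b ∈ C

Lists-RestrictedSum⇒+̂⊆ : ∀ {A B C} → Lists-RestrictedSum C A B → A +̂ B ⊆ C
Lists-RestrictedSum⇒+̂⊆ C≈A+̂B a∈A b∈B a≢b = proj₂ (C≈A+̂B _) (_ , _ , a∈A , b∈B , a≢b , refl)

∉-map-+-below : ∀ a {e m B} → All (m ≤_) B → e < a + m → e ∉ map (a +_) B
∉-map-+-below a m≤B e<a+m e∈a+B with b , b∈B , refl ← ∈-map⁻ (a +_) e∈a+B =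
  <⇒≱ e<a+m (+-monoʳ-≤ a (All.lookup m≤B b∈B))

∉-map-+-above : ∀ a {e M B} → All (_≤ M) B → a + M < e → e ∉ map (a +_) B
∉-map-+-above a B≤M a+M<e e∈a+B with b , b∈B , refl ← ∈-map⁻ (a +_) e∈a+B =
  <⇒≱ a+M<e (+-monoʳ-≤ a (All.lookup B≤M b∈B))

module Translate {A B C : List ℤ} (B-unique : Unique B) (A+̂B⊆C : A +̂ B ⊆ C)
                 {a : ℤ} (a∈A : a ∈ A) where

  private
    a+B-unique : Unique (map (a +_) B)
    a+B-unique = map⁺ (+-cancelˡ-≡ a _ _) B-unique

    a+B⊆C : a ∉ B → map (a +_) B ⊆ C
    a+B⊆C a∉B e∈a+B with b , b∈B , refl ← ∈-map⁻ (a +_) e∈a+B =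
      A+̂B⊆C a∈A b∈B (λ { refl → a∉B b∈B })

    a+B⊆2a∷C : map (a +_) B ⊆ a + a ∷ C
    a+B⊆2a∷C e∈a+B with b , b∈B , refl ← ∈-map⁻ (a +_) e∈a+B with a ≟ b
    ... | yes refl = here refl
    ... | no a≢b   = there (A+̂B⊆C a∈A b∈B a≢b)

  length<-one-outside : a ∉ B → ∀ {e} → e ∈ C → e ∉ map (a +_) B → length B ℕ.< length C
  length<-one-outside a∉B {e} e∈C e∉a+B = begin-strict
    length B                  ≡⟨ sym (length-map (a +_) B) ⟩
    length (map (a +_) B)     <⟨ ℕ.n<1+n _ ⟩
    length (e ∷ map (a +_) B) ≤⟨ Unique-⊆⇒length≤ e∷a+B-unique (∈-∷⁺ʳ e∈C (a+B⊆C a∉B)) ⟩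
    length C                  ∎
    where
      open ℕ.≤-Reasoning
      e∷a+B-unique : Unique (e ∷ map (a +_) B)
      e∷a+B-unique = ¬Any⇒All¬ _ e∉a+B ∷ a+B-unique

  length<-two-outside : ∀ {e₁ e₂} → e₁ ≢ e₂ → e₁ ∈ C → e₂ ∈ C →
                        e₁ ∉ map (a +_) B → e₂ ∉ map (a +_) B → length B ℕ.< length C
  length<-two-outside {e₁} {e₂} e₁≢e₂ e₁∈C e₂∈C e₁∉a+B e₂∉a+B = s≤s⁻¹ (begin
    suc (suc (length B))            ≡⟨ cong (λ n → suc (suc n)) (sym (length-map (a +_) B)) ⟩
    length (e₁ ∷ e₂ ∷ map (a +_) B) ≤⟨ Unique-⊆⇒length≤ e₁e₂a+B-unique e₁e₂a+B⊆2a∷C ⟩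
    suc (length C)                  ∎)
    where
      open ℕ.≤-Reasoning
      e₁e₂a+B-unique : Unique (e₁ ∷ e₂ ∷ map (a +_) B)
      e₁e₂a+B-unique = (e₁≢e₂ ∷ ¬Any⇒All¬ _ e₁∉a+B) ∷ ¬Any⇒All¬ _ e₂∉a+B ∷ a+B-unique
      e₁e₂a+B⊆2a∷C : e₁ ∷ e₂ ∷ map (a +_) B ⊆ a + a ∷ C
      e₁e₂a+B⊆2a∷C = ∈-∷⁺ʳ (there e₁∈C) (∈-∷⁺ʳ (there e₂∈C) a+B⊆2a∷C)

module _ {x y z : ℤ} (x<y : x < y) (y<z : y < z) {B C : List ℤ} (B-unique : Unique B)
         (T+̂B⊆C : (x ∷ y ∷ z ∷ []) +̂ B ⊆ C) where

  open Translate B-unique T+̂B⊆C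

  private
    T : List ℤ
    T = x ∷ y ∷ z ∷ []

    x∈T : x ∈ T
    x∈T = here refl

    y∈T : y ∈ T
    y∈T = there (here refl)

    z∈T : z ∈ T
    z∈T = there (there (here refl))

    x<z : x < z
    x<z = <-trans x<y y<z

  length<-z∉B : ∀ {m} → m ∈ B → All (m ≤_) B → z ∉ B → length B ℕ.< length C
  length<-z∉B {m} m∈B m≤B z∉B with x ≟ m
  ... | no x≢m   = length<-one-outside z∈T z∉B (T+̂B⊆C x∈T m∈B x≢m)
                     (∉-map-+-below z m≤B (+-monoˡ-< m x<z))
  ... | yes refl = length<-one-outside z∈T z∉B (T+̂B⊆C y∈T m∈B (≢-sym (<⇒≢ x<y)))
                     (∉-map-+-below z m≤B (+-monoˡ-< x y<z))

  length<-x∉B : ∀ {M} → M ∈ B → All (_≤ M) B → x ∉ B → length B ℕ.< length C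
  length<-x∉B {M} M∈B B≤M x∉B with z ≟ M
  ... | no z≢M   = length<-one-outside x∈T x∉B (T+̂B⊆C z∈T M∈B z≢M)
                     (∉-map-+-above x B≤M (+-monoˡ-< M x<z))
  ... | yes refl = length<-one-outside x∈T x∉B (T+̂B⊆C y∈T M∈B (<⇒≢ y<z))
                     (∉-map-+-above x B≤M (+-monoˡ-< z x<y))

  length<-min<x : ∀ {m} → m ∈ B → All (m ≤_) B → x ∈ B → x ≢ m → length B ℕ.< length C
  length<-min<x {m} m∈B m≤B x∈B x≢m =
    length<-two-outside z∈T (<⇒≢ (+-monoˡ-< m x<y)) (T+̂B⊆C x∈T m∈B x≢m) (T+̂B⊆C y∈T m∈B y≢m)
      (∉-map-+-below z m≤B (+-monoˡ-< m x<z)) (∉-map-+-below z m≤B (+-monoˡ-< m y<z))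
    where
      y≢m : y ≢ m
      y≢m = ≢-sym (<⇒≢ (≤-<-trans (All.lookup m≤B x∈B) x<y))

  length<-z<max : ∀ {M} → M ∈ B → All (_≤ M) B → z ∈ B → z ≢ M → length B ℕ.< length C
  length<-z<max {M} M∈B B≤M z∈B z≢M =
    length<-two-outside x∈T (<⇒≢ (+-monoˡ-< M y<z)) (T+̂B⊆C y∈T M∈B y≢M) (T+̂B⊆C z∈T M∈B z≢M)
      (∉-map-+-above x B≤M (+-monoˡ-< M x<y)) (∉-map-+-above x B≤M (+-monoˡ-< M x<z))
    where
      y≢M : y ≢ M
      y≢M = <⇒≢ (<-≤-trans y<z (All.lookup B≤M z∈B))

  module _ (x∈B : x ∈ B) (z∈B : z ∈ B) (x≤B : All (x ≤_) B) (B≤z : All (_≤ z) B) where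

    length<-B⊈T : ∃[ b ] b ∈ B × b ∉ T → length B ℕ.< length C
    length<-B⊈T (b , b∈B , b∉T) with <-cmp b y
    ... | tri< b<y _ _ =
      length<-two-outside z∈T (≢-sym (<⇒≢ x+b<y+x)) (T+̂B⊆C y∈T x∈B (≢-sym (<⇒≢ x<y)))
        (T+̂B⊆C x∈T b∈B (λ x≡b → b∉T (here (sym x≡b))))
        (∉-map-+-below z x≤B (+-monoˡ-< x y<z)) (∉-map-+-below z x≤B (<-trans x+b<y+x (+-monoˡ-< x y<z)))
      where
        x+b<y+x : x + b < y + x
        x+b<y+x = <-≤-trans (+-monoʳ-< x b<y) (≤-reflexive (+-comm x y))
    ... | tri≈ _ b≡y _ = contradiction (there (here b≡y)) b∉T
    ... | tri> _ _ y<b =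
      length<-two-outside x∈T (<⇒≢ y+z<z+b) (T+̂B⊆C y∈T z∈B (<⇒≢ y<z))
        (T+̂B⊆C z∈T b∈B (λ z≡b → b∉T (there (there (here (sym z≡b))))))
        (∉-map-+-above x B≤z (+-monoˡ-< z x<y)) (∉-map-+-above x B≤z (<-trans (+-monoˡ-< z x<y) y+z<z+b))
      where
        y+z<z+b : y + z < z + b
        y+z<z+b = ≤-<-trans (≤-reflexive (+-comm y z)) (+-monoʳ-< z y<b)

    x+z∉y+B : B ⊆ T → y ∉ B → x + z ∉ map (y +_) B
    x+z∉y+B B⊆T y∉B x+z∈y+B with b , b∈B , x+z≡y+b ← ∈-map⁻ (y +_) x+z∈y+B with B⊆T b∈B
    ... | here refl                 = ≢-sym (<⇒≢ (+-monoʳ-< x y<z)) (trans x+z≡y+b (+-comm y x))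
    ... | there (here refl)         = y∉B b∈B
    ... | there (there (here refl)) = <⇒≢ (+-monoˡ-< z x<y) x+z≡y+b

    SameSet-or-length<-extremal : SameSet T B ⊎ length B ℕ.< length C
    SameSet-or-length<-extremal with ⊆-or-∉ B T
    ... | inj₂ B⊈T = inj₂ (length<-B⊈T B⊈T)
    ... | inj₁ B⊆T with y ∈? B
    ...   | yes y∈B = inj₁ λ v → T⊆B , B⊆T
      where
        T⊆B : T ⊆ B
        T⊆B (here refl)                 = x∈B
        T⊆B (there (here refl))         = y∈B
        T⊆B (there (there (here refl))) = z∈B
    ...   | no y∉B  = inj₂ (length<-one-outside y∈T y∉B (T+̂B⊆C x∈T z∈B (<⇒≢ x<z)) (x+z∉y+B B⊆T y∉B))

  SameSet-or-length<-sorted : ∀ {m M} → m ∈ B → All (m ≤_) B → M ∈ B → All (_≤ M) B →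
                              SameSet T B ⊎ length B ℕ.< length C
  SameSet-or-length<-sorted {m} {M} m∈B m≤B M∈B B≤M with z ∈? B | x ∈? B | x ≟ m | z ≟ M
  ... | no z∉B  | _       | _        | _        = inj₂ (length<-z∉B m∈B m≤B z∉B)
  ... | yes _   | no x∉B  | _        | _        = inj₂ (length<-x∉B M∈B B≤M x∉B)
  ... | yes _   | yes x∈B | no x≢m   | _        = inj₂ (length<-min<x m∈B m≤B x∈B x≢m)
  ... | yes z∈B | yes _   | yes _    | no z≢M   = inj₂ (length<-z<max M∈B B≤M z∈B z≢M)
  ... | yes z∈B | yes x∈B | yes refl | yes refl = SameSet-or-length<-extremal x∈B z∈B m≤B B≤M

SameSet-or-length< : ∀ {a₁ a₂ a₃ b bs C} → Unique (a₁ ∷ a₂ ∷ a₃ ∷ []) → Unique (b ∷ bs) →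
                     (a₁ ∷ a₂ ∷ a₃ ∷ []) +̂ (b ∷ bs) ⊆ C →
                     SameSet (a₁ ∷ a₂ ∷ a₃ ∷ []) (b ∷ bs) ⊎ length (b ∷ bs) ℕ.< length C
SameSet-or-length< {b = b} {bs} A-unique B-unique A+̂B⊆C
  with x , y , z , x<y , y<z , A↭T ← sort₃ A-unique =
  map₁ (SameSet-trans (↭⇒SameSet A↭T))
       (SameSet-or-length<-sorted x<y y<z B-unique (λ a∈T → A+̂B⊆C (∈-resp-↭ (↭-sym A↭T) a∈T))
          (min∈ b bs) (min≤ b bs) (max∈ b bs) (≤max b bs))

pairSums : ℤ → ℤ → ℤ → List ℤ
pairSums a₁ a₂ a₃ = a₁ + a₂ ∷ a₁ + a₃ ∷ a₂ + a₃ ∷ []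

pairSums-unique : ∀ {a₁ a₂ a₃} → Unique (a₁ ∷ a₂ ∷ a₃ ∷ []) → Unique (pairSums a₁ a₂ a₃)
pairSums-unique {a₁} {a₂} {a₃} ((a₁≢a₂ ∷ a₁≢a₃ ∷ []) ∷ (a₂≢a₃ ∷ []) ∷ [] ∷ []) =
  (a₂≢a₃ ∘ +-cancelˡ-≡ a₁ _ _ ∷ a₁≢a₃ ∘ +-cancelˡ-≡ a₂ _ _ ∘ trans (+-comm a₂ a₁) ∷ [])
  ∷ (a₁≢a₂ ∘ +-cancelʳ-≡ a₃ _ _ ∷ [])
  ∷ [] ∷ []

+-distinct∈pairSums : ∀ {a₁ a₂ a₃ a b} → a ∈ a₁ ∷ a₂ ∷ a₃ ∷ [] → b ∈ a₁ ∷ a₂ ∷ a₃ ∷ [] → a ≢ b →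
                      a + b ∈ pairSums a₁ a₂ a₃
+-distinct∈pairSums (here refl)                 (here refl)                 a≢b = contradiction refl a≢b
+-distinct∈pairSums (there (here refl))         (there (here refl))         a≢b = contradiction refl a≢b
+-distinct∈pairSums (there (there (here refl))) (there (there (here refl))) a≢b = contradiction refl a≢b
+-distinct∈pairSums (here refl)                 (there (here refl))         _   = here refl
+-distinct∈pairSums (here refl)                 (there (there (here refl))) _   = there (here refl)
+-distinct∈pairSums (there (here refl))         (there (there (here refl))) _   = there (there (here refl))
+-distinct∈pairSums {a₁} {a₂}     (there (here refl))         (here refl)         _ = here (+-comm a₂ a₁)
+-distinct∈pairSums {a₁} {_} {a₃} (there (there (here refl))) (here refl)         _ = there (here (+-comm a₃ a₁))
+-distinct∈pairSums {_} {a₂} {a₃} (there (there (here refl))) (there (here refl)) _ =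
  there (there (here (+-comm a₃ a₂)))

length-restrictedSum-self : ∀ {a₁ a₂ a₃ B C} → Unique (a₁ ∷ a₂ ∷ a₃ ∷ []) → Unique C →
                            SameSet (a₁ ∷ a₂ ∷ a₃ ∷ []) B → Lists-RestrictedSum C (a₁ ∷ a₂ ∷ a₃ ∷ []) B →
                            length C ≡ 3
length-restrictedSum-self {a₁} {a₂} {a₃} {C = C}
  A-unique@((a₁≢a₂ ∷ a₁≢a₃ ∷ []) ∷ (a₂≢a₃ ∷ []) ∷ [] ∷ []) C-unique A≈B C≈A+̂B =
  SameSet⇒length≡ C-unique (pairSums-unique A-unique) (λ v → C⊆P , P⊆C)
  where
    C⊆P : C ⊆ pairSums a₁ a₂ a₃
    C⊆P v∈C with a , b , a∈A , b∈B , a≢b , refl ← proj₁ (C≈A+̂B _) v∈C =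
      +-distinct∈pairSums a∈A (proj₂ (A≈B b) b∈B) a≢b
    A+̂A⊆C : (a₁ ∷ a₂ ∷ a₃ ∷ []) +̂ (a₁ ∷ a₂ ∷ a₃ ∷ []) ⊆ C
    A+̂A⊆C a∈A b∈A = Lists-RestrictedSum⇒+̂⊆ C≈A+̂B a∈A (proj₁ (A≈B _) b∈A)
    P⊆C : pairSums a₁ a₂ a₃ ⊆ C
    P⊆C (here refl)                 = A+̂A⊆C (here refl) (there (here refl)) a₁≢a₂
    P⊆C (there (here refl))         = A+̂A⊆C (here refl) (there (there (here refl))) a₁≢a₃
    P⊆C (there (there (here refl))) = A+̂A⊆C (there (here refl)) (there (there (here refl))) a₂≢a₃

theorem2 : (A B C : List ℤ) → Unique A → Unique B → length A ≡ 3 → 2 ℕ.≤ length B →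
    Unique C → Lists-RestrictedSum C A B →
    ((length C ℕ.+ 3 ≡ length A ℕ.+ length B) ⇔ SameSet A B)
theorem2 A@(_ ∷ _ ∷ _ ∷ []) B@(_ ∷ _) C A-unique B-unique refl _ C-unique C≈A+̂B =
  mk⇔ critical⇒A≈B A≈B⇒critical
  where
    critical⇒A≈B : length C ℕ.+ 3 ≡ 3 ℕ.+ length B → SameSet A B
    critical⇒A≈B critical with SameSet-or-length< A-unique B-unique (Lists-RestrictedSum⇒+̂⊆ C≈A+̂B)
    ... | inj₁ A≈B     = A≈B
    ... | inj₂ |B|<|C| =
      contradiction (ℕ.+-cancelʳ-≡ 3 _ _ (trans critical (ℕ.+-comm 3 (length B)))) (ℕ.>⇒≢ |B|<|C|)

    A≈B⇒critical : SameSet A B → length C ℕ.+ 3 ≡ 3 ℕ.+ length B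
    A≈B⇒critical A≈B = cong₂ ℕ._+_ (length-restrictedSum-self A-unique C-unique A≈B C≈A+̂B)
                                   (SameSet⇒length≡ A-unique B-unique A≈B)
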